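{- Let $D[i_p..j_p,\,i_t..j_t]$ be a block of $D$ with $i_p,i_t\ge 1$, so that $P[i_p..j_p]$ is a run of $P$ and $T[i_t..j_t]$ is a run of $T$. Let $h=j_p-i_p$, $w=j_t-i_t$ and $d=d(P[i_p],T[i_t])$. Then for every $i_p<x\le j_p$, $$D[x,j_t]=\begin{cases} D[i_p,\,j_t-(x-i_p)]+(x-i_p)\cdot d & \text{if } x-i_p\le w,\\ D[x-w,\,i_t]+w\cdot d & \text{otherwise,}\end{cases}$$ and for every $i_t<y\le j_t$, $$D[j_p,y]=\begin{cases} D[j_p-(y-i_t),\,i_t]+(y-i_t)\cdot d & \text{if } y-i_t\le h,\\ D[i_p,\,y-h]+h\cdot d & \text{otherwise.}\end{cases}$$
   Context: $\Sigma$ is an alphabet and $d:\Sigma\times\Sigma\to\mathbb{R}_{\ge 0}$ satisfies $d(a,a)=0$ and $d(a,b)>0$ for $a\ne b$. $P$ is a pattern of length $M$ and $T$ a text of length $N$, both indexed from $1$. A run of a string is a maximal substring consisting of one repeated letter. $\mathrm{DTW}_d(X,Y)$ is $0$ if both strings are empty and $\infty$ if exactly one is empty. Otherwise it is the minimum, over warping paths $\pi$ from $(1,1)$ to $(|X|,|Y|)$, of $\sum_{(i,j)\in\pi}d(X[i],Y[j])$, where each step goes from $(i,j)$ to $(i+1,j)$, $(i+1,j+1)$ or $(i,j+1)$. $D$ is the $(M+1)\times(N+1)$ table with rows $0..M$ and columns $0..N$, defined by $D[0,j]=0$, $D[i,0]=+\infty$ for $i\ge1$, and, for $i,j\ge1$,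 $D[i,j]$ equal to the smallest $\mathrm{DTW}_d$ distance between $P[1..i]$ and a suffix of $T[1..j]$. A block is a subtable $D[i_p..j_p,\,i_t..j_t]$ where $P[i_p..j_p]$ is a run of $P$ or $i_p=j_p=0$, and $T[i_t..j_t]$ is a run of $T$ or $i_t=j_t=0$. -}

module Defs where

open import Level using (0ℓ)
open import Data.Nat using (ℕ; zero; suc; _∸_; _≤_; _<_)
import Data.Nat as ℕ
open import Data.Product using (Σ; ∃; _×_; _,_)
open import Data.Sum using (_⊎_)
open import Relation.Nullary using (¬_)
open import Relation.Binary.PropositionalEquality using (_≡_; _≢_)
open import Relation.Binary.Structures using (IsTotalOrder)
open import Algebra.Structures using (IsCommutativeMonoid)

-- Cost domain: an abstraction of ℝ≥0 (nonnegative reals with +, ≤).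
-- Every field below holds for ℝ≥0, so ℝ≥0 is an instance.

record CostDomain : Set₁ where
  infixl 6 _+_
  infix 4 _≤ᶜ_
  field
    Carrier : Set
    _+_     : Carrier → Carrier → Carrier
    0#      : Carrier
    _≤ᶜ_    : Carrier → Carrier → Set
    isCommutativeMonoid : IsCommutativeMonoid _≡_ _+_ 0#
    isTotalOrder        : IsTotalOrder _≡_ _≤ᶜ_
    +-monoˡ-≤ : ∀ {x y} z → x ≤ᶜ y → x + z ≤ᶜ y + z
    0≤        : ∀ x → 0# ≤ᶜ x

  infixr 7 _·_
  _·_ : ℕ → Carrier → Carrier
  zero  · c = 0#
  suc k · c = c + k · c

-- Dynamic time warping over a cost domain C and alphabet A with distance d.
-- Strings are 1-indexed: a string of length n is a function X : ℕ → A
-- together with n, and X[k] = X k for 1 ≤ k ≤ n.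

module DTW (C : CostDomain) {A : Set} (d : A → A → CostDomain.Carrier C) where
  open CostDomain C

  data Path : ℕ → ℕ → Set where
    start : Path 1 1
    down  : ∀ {i j} → Path i j → Path (suc i) j
    diag  : ∀ {i j} → Path i j → Path (suc i) (suc j)
    right : ∀ {i j} → Path i j → Path i (suc j)

  cost : (X Y : ℕ → A) → ∀ {i j} → Path i j → Carrier
  cost X Y start             = d (X 1) (Y 1)
  cost X Y (down  {i} {j} p) = cost X Y p + d (X (suc i)) (Y j)
  cost X Y (diag  {i} {j} p) = cost X Y p + d (X (suc i)) (Y (suc j))
  cost X Y (right {i} {j} p) = cost X Y p + d (X i) (Y (suc j))

  IsDTW : (X : ℕ → A) (n : ℕ) (Y : ℕ → A) (m : ℕ) → Carrier → Set
  IsDTW X n Y m v =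
    (Σ (Path n m) λ p → cost X Y p ≡ v) × (∀ (p : Path n m) → v ≤ᶜ cost X Y p)

  -- The substring T[s..j] (s ≥ 1) as a 1-indexed string of length j + 1 ∸ s.
  sub : (ℕ → A) → ℕ → ℕ → A
  sub T s k = T (s ∸ 1 ℕ.+ k)

  -- IsD P T i j v (for i, j ≥ 1): v = D[i,j], the smallest DTW distance
  -- between P[1..i] and a (nonempty) suffix T[s..j], 1 ≤ s ≤ j, of T[1..j].
  IsD : (P T : ℕ → A) → ℕ → ℕ → Carrier → Set
  IsD P T i j v =
    (∃ λ s → 1 ≤ s × s ≤ j × IsDTW P i (sub T s) (j ∸ s ℕ.+ 1) v)
    × (∀ s w → 1 ≤ s → s ≤ j → IsDTW P i (sub T s) (j ∸ s ℕ.+ 1) w → v ≤ᶜ w)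

IsRun : {A : Set} → (ℕ → A) → ℕ → ℕ → ℕ → Set
IsRun S n i j =
  1 ≤ i × i ≤ j × j ≤ n
  × (∀ k → i ≤ k → k ≤ j → S k ≡ S i)
  × (i ≡ 1 ⊎ S (i ∸ 1) ≢ S i)
  × (j ≡ n ⊎ S (suc j) ≢ S i)

-- D is computed by the usual recurrence D[i,j] = min(D[i-1,j-1], D[i-1,j], D[i,j-1]) + d(P[i],T[j]).
-- Inside a block all cell costs equal δ, and since costs are nonnegative, repeating a letter of P
-- (resp. T) cannot decrease D along a column (resp. row). Hence in the recurrence the diagonal
-- predecessor is always a minimum, so D grows by exactly δ along every diagonal of the block.
-- Following the diagonal back from a cell on the last row or column of the block until it leaves
-- through the first row or column gives the two cases of each formula.
module Submission where

open import Level using (0ℓ)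
open import Data.Nat using (ℕ; zero; suc; _∸_; _≤_; _<_; z≤n; s≤s)
import Data.Nat as ℕ
open import Data.Nat.Properties
  using ( ≤-refl; ≤-reflexive; ≤-trans; ≤-<-trans; <-≤-trans; <⇒≤; n≤1+n; m≤n⇒m≤1+n; m≤n+m
        ; +-suc; +-comm; +-∸-assoc; m+n∸n≡m; m∸n+n≡m; m+[n∸m]≡n; m∸[m∸n]≡n; m∸n≤m; ∸-monoʳ-≤; ∸-monoʳ-< )
open import Data.Product using (∃; _×_; _,_)
open import Data.Sum using ([_,_]′)
open import Data.Empty using (⊥-elim)
open import Relation.Nullary using (¬_)
open import Relation.Binary.PropositionalEquality
  using (_≡_; _≢_; refl; sym; trans; cong; cong₂; subst; subst₂; module ≡-Reasoning)
open import Relation.Binary.Bundles using (TotalOrder)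
open import Relation.Binary.Structures using (IsTotalOrder)
open import Algebra.Structures using (IsCommutativeMonoid)
import Algebra.Construct.NaturalChoice.Min as Min

open import Defs

m≤o∸n⇒n≤o∸m : ∀ {m n o} → n ≤ o → m ≤ o ∸ n → n ≤ o ∸ m
m≤o∸n⇒n≤o∸m {m} {n} {o} n≤o m≤o∸n = subst (_≤ o ∸ m) (m∸[m∸n]≡n n≤o) (∸-monoʳ-≤ o m≤o∸n)

ConstantOn : {A : Set} → (ℕ → A) → A → ℕ → ℕ → Set
ConstantOn S a lo hi = ∀ t → lo ≤ t → t ≤ hi → S t ≡ a

module _ {A : Set} {S : ℕ → A} {a : A} where

  ConstantOn-⊆ : ∀ {lo hi lo′ hi′} → lo ≤ lo′ → hi′ ≤ hi → ConstantOn S a lo hi → ConstantOn S a lo′ hi′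
  ConstantOn-⊆ lo≤lo′ hi′≤hi const t lo′≤t t≤hi′ = const t (≤-trans lo≤lo′ lo′≤t) (≤-trans t≤hi′ hi′≤hi)

  ConstantOn-adjacent : ∀ {lo hi} → lo ≤ hi → ConstantOn S a lo (suc hi) → S (suc hi) ≡ S hi
  ConstantOn-adjacent {hi = hi} lo≤hi const =
    trans (const (suc hi) (m≤n⇒m≤1+n lo≤hi) ≤-refl) (sym (const hi lo≤hi (n≤1+n hi)))

module CostDomainProperties (C : CostDomain) where
  open CostDomain C
  open IsCommutativeMonoid isCommutativeMonoid using (identityˡ; comm)
  open IsTotalOrder isTotalOrder public
    using (antisym) renaming (refl to ≤ᶜ-refl; trans to ≤ᶜ-trans; reflexive to ≤ᶜ-reflexive)

  totalOrder : TotalOrder 0ℓ 0ℓ 0ℓ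
  totalOrder = record { Carrier = Carrier ; _≈_ = _≡_ ; _≤_ = _≤ᶜ_ ; isTotalOrder = isTotalOrder }

  open Min totalOrder public using (_⊓_; x⊓y≤x; x⊓y≤y; x≤y⇒z⊓x≤y; x≤y⇒x⊓y≈x; ⊓-glb)
  open Min totalOrder using (⊓-sel)

  ⊓-elim : (R : Carrier → Set) {x y : Carrier} → R x → R y → R (x ⊓ y)
  ⊓-elim R Rx Ry = [ (λ eq → subst R (sym eq) Rx) , (λ eq → subst R (sym eq) Ry) ]′ (⊓-sel _ _)

  x≤y+x : ∀ x y → x ≤ᶜ y + x
  x≤y+x x y = subst (_≤ᶜ y + x) (identityˡ x) (+-monoˡ-≤ x (0≤ y))

  x≤x+y : ∀ x y → x ≤ᶜ x + y
  x≤x+y x y = subst (x ≤ᶜ_) (comm y x) (x≤y+x x y)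

module Table (C : CostDomain) {A : Set} (d : A → A → CostDomain.Carrier C) (P T : ℕ → A) where
  open CostDomain C
  open CostDomainProperties C
  open IsCommutativeMonoid isCommutativeMonoid using (assoc; comm; identityʳ)
  open DTW C d

  -- table i j is D[i+1, j+1]; the shift drops row 0 and column 0, whose entries 0 and ∞
  -- are not needed (and ∞ is not a cost).
  cell : ℕ → ℕ → Carrier
  cell i j = d (P (suc i)) (T (suc j))

  table : ℕ → ℕ → Carrier
  table zero    j       = cell zero j
  table (suc i) zero    = table i zero + cell (suc i) zero
  table (suc i) (suc j) = (table i j ⊓ (table i (suc j) ⊓ table (suc i) j)) + cell (suc i) (suc j)

  table-≤-diag : ∀ i j → table (suc i) (suc j) ≤ᶜ table i j + cell (suc i) (suc j)
  table-≤-diag i j = +-monoˡ-≤ _ (x⊓y≤x _ _)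

  table-≤-down : ∀ i j → table (suc i) j ≤ᶜ table i j + cell (suc i) j
  table-≤-down i zero    = ≤ᶜ-refl
  table-≤-down i (suc j) = +-monoˡ-≤ _ (x≤y⇒z⊓x≤y _ (x⊓y≤x _ _))

  table-≤-right : ∀ i j → table i (suc j) ≤ᶜ table i j + cell i (suc j)
  table-≤-right zero    j = x≤y+x _ _
  table-≤-right (suc i) j = +-monoˡ-≤ _ (x≤y⇒z⊓x≤y _ (x⊓y≤y _ _))

  table-≤-next-row : ∀ {i} → P (suc (suc i)) ≡ P (suc i) → ∀ j → table i j ≤ᶜ table (suc i) j
  table-≤-next-row _    zero    = x≤x+y _ _
  table-≤-next-row {i} same (suc j) =
    ⊓-elim bounds (via-right ≤ᶜ-refl) (⊓-elim bounds (x≤x+y _ _) (via-right (table-≤-next-row same j)))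
    where
      bounds : Carrier → Set
      bounds v = table i (suc j) ≤ᶜ v + cell (suc i) (suc j)
      via-right : ∀ {y} → table i j ≤ᶜ y → table i (suc j) ≤ᶜ y + cell (suc i) (suc j)
      via-right table≤y =
        subst (λ c → table i (suc j) ≤ᶜ _ + c) (cong (λ a → d a (T (suc (suc j)))) (sym same))
          (≤ᶜ-trans (table-≤-right i j) (+-monoˡ-≤ _ table≤y))

  table-≤-next-column : ∀ {j} → T (suc (suc j)) ≡ T (suc j) → ∀ i → table i j ≤ᶜ table i (suc j)
  table-≤-next-column same zero    = ≤ᶜ-reflexive (cong (d (P 1)) (sym same))
  table-≤-next-column {j} same (suc i) =
    ⊓-elim bounds (via-down ≤ᶜ-refl) (⊓-elim bounds (via-down (table-≤-next-column same i)) (x≤x+y _ _))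
    where
      bounds : Carrier → Set
      bounds v = table (suc i) j ≤ᶜ v + cell (suc i) (suc j)
      via-down : ∀ {y} → table i j ≤ᶜ y → table (suc i) j ≤ᶜ y + cell (suc i) (suc j)
      via-down table≤y =
        subst (λ c → table (suc i) j ≤ᶜ _ + c) (cong (d (P (suc (suc i)))) (sym same))
          (≤ᶜ-trans (table-≤-down i j) (+-monoˡ-≤ _ table≤y))

  table-diagonal-step : ∀ {i j} → P (suc (suc i)) ≡ P (suc i) → T (suc (suc j)) ≡ T (suc j) →
                        table (suc i) (suc j) ≡ table i j + cell (suc i) (suc j)
  table-diagonal-step {i} {j} sameP sameT =
    cong (_+ cell (suc i) (suc j))
      (x≤y⇒x⊓y≈x (⊓-glb (table-≤-next-column sameT i) (table-≤-next-row sameP j)))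

  table-diagonal : ∀ k {i j a b} →
                   ConstantOn P a (suc i) (suc (k ℕ.+ i)) → ConstantOn T b (suc j) (suc (k ℕ.+ j)) →
                   table (k ℕ.+ i) (k ℕ.+ j) ≡ table i j + k · d a b
  table-diagonal zero _ _ = sym (identityʳ _)
  table-diagonal (suc k) {i} {j} {a} {b} P-const T-const = begin
    table (suc (k ℕ.+ i)) (suc (k ℕ.+ j))
      ≡⟨ table-diagonal-step (ConstantOn-adjacent (s≤s (m≤n+m i k)) P-const)
                             (ConstantOn-adjacent (s≤s (m≤n+m j k)) T-const) ⟩
    table (k ℕ.+ i) (k ℕ.+ j) + cell (suc (k ℕ.+ i)) (suc (k ℕ.+ j))
      ≡⟨ cong₂ _+_ (table-diagonal k (ConstantOn-⊆ ≤-refl (n≤1+n _) P-const)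
                                     (ConstantOn-⊆ ≤-refl (n≤1+n _) T-const))
                   (cong₂ d (P-const _ (s≤s (m≤n+m i (suc k))) ≤-refl)
                            (T-const _ (s≤s (m≤n+m j (suc k))) ≤-refl)) ⟩
    (table i j + k · d a b) + d a b
      ≡⟨ trans (assoc _ _ _) (cong (table i j +_) (comm _ _)) ⟩
    table i j + suc k · d a b ∎
    where open ≡-Reasoning

  ¬Path-zero-row : ∀ {m} → ¬ Path 0 m
  ¬Path-zero-row (right p) = ¬Path-zero-row p

  ¬Path-zero-column : ∀ {n} → ¬ Path n 0
  ¬Path-zero-column (down p) = ¬Path-zero-column p

  sub-cell : ∀ s i m → d (P (suc i)) (sub T (suc s) (suc m)) ≡ cell i (m ℕ.+ s)
  sub-cell s i m = cong (λ t → d (P (suc i)) (T t)) (trans (+-suc s m) (cong suc (+-comm s m)))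

  lower-via : ∀ {s i m x y z} → x ≤ᶜ y + cell i (m ℕ.+ s) → y ≤ᶜ z →
              x ≤ᶜ z + d (P (suc i)) (sub T (suc s) (suc m))
  lower-via {s} {i} {m} x≤y+c y≤z =
    subst (λ c → _ ≤ᶜ _ + c) (sym (sub-cell s i m)) (≤ᶜ-trans x≤y+c (+-monoˡ-≤ _ y≤z))

  path-cost-lower : ∀ s {i m} (p : Path (suc i) (suc m)) → table i (m ℕ.+ s) ≤ᶜ cost P (sub T (suc s)) p
  path-cost-lower s start                     = ≤ᶜ-reflexive (sym (sub-cell s 0 0))
  path-cost-lower s (down {zero} p)           = ⊥-elim (¬Path-zero-row p)
  path-cost-lower s (down {suc i} p)          = lower-via (table-≤-down i _) (path-cost-lower s p)
  path-cost-lower s (diag {zero} p)           = ⊥-elim (¬Path-zero-row p)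
  path-cost-lower s (diag {suc i} {zero} p)   = ⊥-elim (¬Path-zero-column p)
  path-cost-lower s (diag {suc i} {suc _} p)  = lower-via (table-≤-diag i _) (path-cost-lower s p)
  path-cost-lower s (right {j = zero} p)      = ⊥-elim (¬Path-zero-column p)
  path-cost-lower s (right {suc i} {suc _} p) = lower-via (table-≤-right i _) (path-cost-lower s p)

  table-≤-isDTW : ∀ {i j s w} → s ≤ j → IsDTW P (suc i) (sub T (suc s)) (j ∸ s ℕ.+ 1) w → table i j ≤ᶜ w
  table-≤-isDTW {i} {j} {s} s≤j ((p , refl) , _) =
    subst (λ c → table i c ≤ᶜ cost P (sub T (suc s)) p) (m∸n+n≡m s≤j) (lower-at-length (+-comm (j ∸ s) 1) p)
    where
      lower-at-length : ∀ {n m} → n ≡ suc m → (q : Path (suc i) n) →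
                        table i (m ℕ.+ s) ≤ᶜ cost P (sub T (suc s)) q
      lower-at-length refl = path-cost-lower s

  record Alignment (i j : ℕ) (v : Carrier) : Set where
    constructor alignment
    field
      offset width : ℕ
      ends-at      : width ℕ.+ offset ≡ j
      path         : Path (suc i) (suc width)
      path-cost    : cost P (sub T (suc offset)) path ≡ v

  extend-down : ∀ {i j v} → Alignment i j v → Alignment (suc i) j (v + cell (suc i) j)
  extend-down {i} (alignment s m refl p refl) =
    alignment s m refl (down p) (cong (cost P (sub T (suc s)) p +_) (sub-cell s (suc i) m))

  extend-diag : ∀ {i j v} → Alignment i j v → Alignment (suc i) (suc j) (v + cell (suc i) (suc j))
  extend-diag {i} (alignment s m refl p refl) =
    alignment s (suc m) refl (diag p) (cong (cost P (sub T (suc s)) p +_) (sub-cell s (suc i) (suc m)))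

  extend-right : ∀ {i j v} → Alignment i j v → Alignment i (suc j) (v + cell i (suc j))
  extend-right {i} (alignment s m refl p refl) =
    alignment s (suc m) refl (right p) (cong (cost P (sub T (suc s)) p +_) (sub-cell s i (suc m)))

  optimal-alignment : ∀ i j → Alignment i j (table i j)
  optimal-alignment zero    j       = alignment j 0 refl start (sub-cell j 0 0)
  optimal-alignment (suc i) zero    = extend-down (optimal-alignment i zero)
  optimal-alignment (suc i) (suc j) =
    ⊓-elim ending (extend-diag (optimal-alignment i j))
      (⊓-elim ending (extend-down (optimal-alignment i (suc j))) (extend-right (optimal-alignment (suc i) j)))
    where
      ending : Carrier → Set
      ending v = Alignment (suc i) (suc j) (v + cell (suc i) (suc j))

  table-attained : ∀ {i j} → Alignment i j (table i j) →
                   ∃ λ s → 1 ≤ s × s ≤ suc j × IsDTW P (suc i) (sub T s) (suc j ∸ s ℕ.+ 1) (table i j)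
  table-attained {i} (alignment s m refl p cost≡) =
    suc s , s≤s z≤n , s≤s (m≤n+m s m) ,
    subst (λ n → IsDTW P (suc i) (sub T (suc s)) n (table i (m ℕ.+ s))) (sym length)
      ((p , cost≡) , path-cost-lower s)
    where
      length : m ℕ.+ s ∸ s ℕ.+ 1 ≡ suc m
      length = trans (cong (ℕ._+ 1) (m+n∸n≡m m s)) (+-comm m 1)

  table-isD : ∀ i j → IsD P T (suc i) (suc j) (table i j)
  table-isD i j = table-attained (optimal-alignment i j) , least
    where
      least : ∀ s w → 1 ≤ s → s ≤ suc j → IsDTW P (suc i) (sub T s) (suc j ∸ s ℕ.+ 1) w → table i j ≤ᶜ w
      least (suc s) w _ (s≤s s≤j) = table-≤-isDTW s≤j

  IsD-unique : ∀ {i j v v′} → IsD P T i j v → IsD P T i j v′ → v ≡ v′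
  IsD-unique ((s , 1≤s , s≤j , dtw) , least) ((s′ , 1≤s′ , s′≤j , dtw′) , least′) =
    antisym (least s′ _ 1≤s′ s′≤j dtw′) (least′ s _ 1≤s s≤j dtw)

  isD-diagonal : ∀ k {x y a b v} → k < x → k < y →
                 ConstantOn P a (x ∸ k) x → ConstantOn T b (y ∸ k) y →
                 IsD P T (x ∸ k) (y ∸ k) v → IsD P T x y (v + k · d a b)
  isD-diagonal k {suc x} {suc y} {a} {b} {v} (s≤s k≤x) (s≤s k≤y) P-const T-const isD =
    subst₂ (λ r c → IsD P T r c (v + k · d a b)) (last k≤x) (last k≤y)
      (subst (IsD P T _ _) table≡ (table-isD (k ℕ.+ (x ∸ k)) (k ℕ.+ (y ∸ k))))
    where
      open ≡-Reasoning
      first : ∀ {n} → k ≤ n → suc n ∸ k ≡ suc (n ∸ k)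
      first = +-∸-assoc 1
      last : ∀ {n} → k ≤ n → suc (k ℕ.+ (n ∸ k)) ≡ suc n
      last k≤n = cong suc (m+[n∸m]≡n k≤n)
      table≡ : table (k ℕ.+ (x ∸ k)) (k ℕ.+ (y ∸ k)) ≡ v + k · d a b
      table≡ = begin
        table (k ℕ.+ (x ∸ k)) (k ℕ.+ (y ∸ k))
          ≡⟨ table-diagonal k (subst₂ (ConstantOn P a) (first k≤x) (sym (last k≤x)) P-const)
                              (subst₂ (ConstantOn T b) (first k≤y) (sym (last k≤y)) T-const) ⟩
        table (x ∸ k) (y ∸ k) + k · d a b
          ≡⟨ cong (_+ k · d a b)
                  (IsD-unique (table-isD (x ∸ k) (y ∸ k))
                              (subst₂ (λ r c → IsD P T r c v) (first k≤x) (first k≤y) isD)) ⟩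
        v + k · d a b ∎

module Block (C : CostDomain) {A : Set} (d : A → A → CostDomain.Carrier C) (P T : ℕ → A)
  {ip jp it jt : ℕ}
  (1≤ip : 1 ≤ ip) (ip≤jp : ip ≤ jp) (P-const : ConstantOn P (P ip) ip jp)
  (1≤it : 1 ≤ it) (it≤jt : it ≤ jt) (T-const : ConstantOn T (T it) it jt) where
  open CostDomain C
  open DTW C d
  open Table C d P T using (isD-diagonal)

  private
    h w : ℕ
    h = jp ∸ ip
    w = jt ∸ it
    δ : Carrier
    δ = d (P ip) (T it)

  right-edge-from-top : ∀ x → ip < x → x ≤ jp → x ∸ ip ≤ w →
                        ∀ v → IsD P T ip (jt ∸ (x ∸ ip)) v → IsD P T x jt (v + (x ∸ ip) · δ)
  right-edge-from-top x ip<x x≤jp k≤w v isD =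
    isD-diagonal k (∸-monoʳ-< 1≤ip ip≤x) (≤-<-trans k≤w (∸-monoʳ-< 1≤it it≤jt))
      (ConstantOn-⊆ (≤-reflexive (sym x∸k≡ip)) x≤jp P-const)
      (ConstantOn-⊆ (m≤o∸n⇒n≤o∸m it≤jt k≤w) ≤-refl T-const)
      (subst (λ r → IsD P T r (jt ∸ k) v) (sym x∸k≡ip) isD)
    where
      k : ℕ
      k = x ∸ ip
      ip≤x : ip ≤ x
      ip≤x = <⇒≤ ip<x
      x∸k≡ip : x ∸ k ≡ ip
      x∸k≡ip = m∸[m∸n]≡n ip≤x

  right-edge-from-left : ∀ x → ip < x → x ≤ jp → w < x ∸ ip →
                         ∀ v → IsD P T (x ∸ w) it v → IsD P T x jt (v + w · δ)
  right-edge-from-left x ip<x x≤jp w<k v isD =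
    isD-diagonal w (<-≤-trans w<k (m∸n≤m x ip)) (∸-monoʳ-< 1≤it it≤jt)
      (ConstantOn-⊆ (m≤o∸n⇒n≤o∸m (<⇒≤ ip<x) (<⇒≤ w<k)) x≤jp P-const)
      (ConstantOn-⊆ (≤-reflexive (sym jt∸w≡it)) ≤-refl T-const)
      (subst (λ c → IsD P T (x ∸ w) c v) (sym jt∸w≡it) isD)
    where
      jt∸w≡it : jt ∸ w ≡ it
      jt∸w≡it = m∸[m∸n]≡n it≤jt

  bottom-edge-from-left : ∀ y → it < y → y ≤ jt → y ∸ it ≤ h →
                          ∀ v → IsD P T (jp ∸ (y ∸ it)) it v → IsD P T jp y (v + (y ∸ it) · δ)
  bottom-edge-from-left y it<y y≤jt k≤h v isD =
    isD-diagonal k (≤-<-trans k≤h (∸-monoʳ-< 1≤ip ip≤jp)) (∸-monoʳ-< 1≤it it≤y)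
      (ConstantOn-⊆ (m≤o∸n⇒n≤o∸m ip≤jp k≤h) ≤-refl P-const)
      (ConstantOn-⊆ (≤-reflexive (sym y∸k≡it)) y≤jt T-const)
      (subst (λ c → IsD P T (jp ∸ k) c v) (sym y∸k≡it) isD)
    where
      k : ℕ
      k = y ∸ it
      it≤y : it ≤ y
      it≤y = <⇒≤ it<y
      y∸k≡it : y ∸ k ≡ it
      y∸k≡it = m∸[m∸n]≡n it≤y

  bottom-edge-from-top : ∀ y → it < y → y ≤ jt → h < y ∸ it →
                         ∀ v → IsD P T ip (y ∸ h) v → IsD P T jp y (v + h · δ)
  bottom-edge-from-top y it<y y≤jt h<k v isD =
    isD-diagonal h (∸-monoʳ-< 1≤ip ip≤jp) (<-≤-trans h<k (m∸n≤m y it))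
      (ConstantOn-⊆ (≤-reflexive (sym jp∸h≡ip)) ≤-refl P-const)
      (ConstantOn-⊆ (m≤o∸n⇒n≤o∸m (<⇒≤ it<y) (<⇒≤ h<k)) y≤jt T-const)
      (subst (λ r → IsD P T r (y ∸ h) v) (sym jp∸h≡ip) isD)
    where
      jp∸h≡ip : jp ∸ h ≡ ip
      jp∸h≡ip = m∸[m∸n]≡n ip≤jp

-- The identity only uses that costs are nonnegative.
lemma4 : (C : CostDomain) → let open CostDomain C in
    {A : Set} (d : A → A → Carrier) →
    (∀ a → d a a ≡ 0#) → (∀ a b → a ≢ b → d a b ≢ 0#) →
    let open DTW C d in
    (M N : ℕ) (P T : ℕ → A) (ip jp it jt : ℕ) →
    IsRun P M ip jp → IsRun T N it jt →
    let h = jp ∸ ip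
        w = jt ∸ it
        δ = d (P ip) (T it)
    in
    (∀ x → ip < x → x ≤ jp →
      (x ∸ ip ≤ w → ∀ v → IsD P T ip (jt ∸ (x ∸ ip)) v
                        → IsD P T x jt (v + (x ∸ ip) · δ))
      × (w < x ∸ ip → ∀ v → IsD P T (x ∸ w) it v
                        → IsD P T x jt (v + w · δ)))
    × (∀ y → it < y → y ≤ jt →
      (y ∸ it ≤ h → ∀ v → IsD P T (jp ∸ (y ∸ it)) it v
                        → IsD P T jp y (v + (y ∸ it) · δ))
      × (h < y ∸ it → ∀ v → IsD P T ip (y ∸ h) v
                        → IsD P T jp y (v + h · δ)))
lemma4 C d _ _ M N P T ip jp it jt (1≤ip , ip≤jp , _ , P-const , _) (1≤it , it≤jt , _ , T-const , _) =
  (λ x ip<x x≤jp → right-edge-from-top x ip<x x≤jp , right-edge-from-left x ip<x x≤jp) ,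
  (λ y it<y y≤jt → bottom-edge-from-left y it<y y≤jt , bottom-edge-from-top y it<y y≤jt)
  where open Block C d P T 1≤ip ip≤jp P-const 1≤it it≤jt T-const
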